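{- For $r\ge 1$ and $n\ge 0$ let $a_{r,n}$ be the number of permutations in $\mathcal{P}_n(132)$ with exactly $r$ right-to-left maxima. Then for all $r\ge1$, $$\sum_{n\ge 0}a_{r,n}x^n = \frac{x^r(1+x)^{r-1}(1-x-x^2)}{1-2x-x^2}.$$ In particular, $a_{1,n}=p_{n-1}$ for $n\ge 2$, $a_{2,n} = p_{n-2}+p_{n-3}$ for $n\ge 4$, and $a_{3,n} = 2p_{n-3}$ for $n\ge 6$.
   Context: $S_n$ is the set of permutations of $\{1,\dots,n\}$ in one-line notation. A permutation avoids a pattern $\sigma\in S_k$ if it has no subsequence of length $k$ whose entries are in the same relative order as $\sigma$. $\mathcal{P}_n(132)$ is the set of permutations in $S_n$ avoiding each of $132$, $2341$, $3241$ (equivalently, the two-stack sortable permutations avoiding $132$); $\mathcal{P}_0(132)$ contains only the empty permutation. A right-to-left maximum of $\pi$ is a position $i$ with $\pi(i)>\pi(j)$ for all $j>i$. The Pell numbers are $p_0=0$, $p_1=1$, $p_n=2p_{n-1}+p_{n-2}$ for $n\ge 2$. -}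

module Defs where

open import Data.Nat using (ℕ; zero; suc; _+_; _*_; _∸_; _<ᵇ_; _≡ᵇ_)
open import Data.Integer as ℤ using (ℤ; +_; -_)
open import Data.Bool using (Bool; true; false; _∧_; not; if_then_else_)
open import Data.List using (List; []; _∷_; _++_; map; concatMap; length; filter; upTo; foldr)
open import Data.Bool.ListAction using (all; any)
open import Data.Product using (_,_)
open import Relation.Nullary.Decidable using (Dec)
open import Data.Bool using (T)
open import Data.Bool.Properties using (T?)

-- Permutations of {1,…,n} in one-line notation, as lists of naturals.

insertions : ℕ → List ℕ → List (List ℕ)
insertions x []       = (x ∷ []) ∷ []
insertions x (y ∷ ys) = (x ∷ y ∷ ys) ∷ map (y ∷_) (insertions x ys)

perms : ℕ → List (List ℕ)
perms zero    = [] ∷ []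
perms (suc n) = concatMap (insertions (suc n)) (perms n)

subseqs : ℕ → List ℕ → List (List ℕ)
subseqs zero    _        = [] ∷ []
subseqs (suc k) []       = []
subseqs (suc k) (x ∷ xs) = map (x ∷_) (subseqs k xs) ++ subseqs (suc k) xs

sameCmp : ℕ → List ℕ → ℕ → List ℕ → Bool
sameCmp x []       u []       = true
sameCmp x (y ∷ ys) u (v ∷ vs) = ((x <ᵇ y) ≡ᵇB (u <ᵇ v)) ∧ sameCmp x ys u vs
  where
  _≡ᵇB_ : Bool → Bool → Bool
  true  ≡ᵇB b = b
  false ≡ᵇB b = not b
sameCmp x _        u _        = false

orderIso : List ℕ → List ℕ → Bool
orderIso []       []       = true
orderIso (x ∷ xs) (u ∷ us) = sameCmp x xs u us ∧ orderIso xs us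
orderIso _        _        = false

contains : List ℕ → List ℕ → Bool
contains σ π = any (orderIso σ) (subseqs (length σ) π)

avoids : List ℕ → List ℕ → Bool
avoids σ π = not (contains σ π)

p132 p2341 p3241 : List ℕ
p132  = 1 ∷ 3 ∷ 2 ∷ []
p2341 = 2 ∷ 3 ∷ 4 ∷ 1 ∷ []
p3241 = 3 ∷ 2 ∷ 4 ∷ 1 ∷ []

inP132 : List ℕ → Bool
inP132 π = avoids p132 π ∧ avoids p2341 π ∧ avoids p3241 π

rlMax : List ℕ → ℕ
rlMax []       = 0
rlMax (x ∷ xs) = (if all (_<ᵇ x) xs then 1 else 0) + rlMax xs

a : ℕ → ℕ → ℕ
a r n = length (filter (λ π → T? (inP132 π ∧ (rlMax π ≡ᵇ r))) (perms n))

pell : ℕ → ℕ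
pell zero          = 0
pell (suc zero)    = 1
pell (suc (suc n)) = 2 * pell (suc n) + pell n

-- Formal power series over ℤ, as coefficient sequences ℕ → ℤ.

Series : Set
Series = ℕ → ℤ

_⊛_ : Series → Series → Series
(f ⊛ g) n = foldr ℤ._+_ (+ 0) (map (λ i → f i ℤ.* g (n ∸ i)) (upTo (suc n)))

poly : List ℤ → Series
poly []       n       = + 0
poly (c ∷ cs) zero    = c
poly (c ∷ cs) (suc n) = poly cs n

one : Series
one = poly (+ 1 ∷ [])

_^ₛ_ : Series → ℕ → Series
f ^ₛ zero    = one
f ^ₛ suc k   = f ⊛ (f ^ₛ k)

X : Series
X = poly (+ 0 ∷ + 1 ∷ [])

onePlusX : Series
onePlusX = poly (+ 1 ∷ + 1 ∷ [])

oneMinusXMinusX² : Series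
oneMinusXMinusX² = poly (+ 1 ∷ - + 1 ∷ - + 1 ∷ [])

-- 1 - 2x - x²  (the denominator; invertible since its constant term is 1)
denom : Series
denom = poly (+ 1 ∷ - + 2 ∷ - + 1 ∷ [])

numer : ℕ → Series
numer r = (X ^ₛ r) ⊛ ((onePlusX ^ₛ (r ∸ 1)) ⊛ oneMinusXMinusX²)

A : ℕ → Series
A r n = + (a r n)

{-# OPTIONS --safe #-}
-- Every permutation of length n + 1 arises from one of length n by inserting the new maximum
-- m = n + 1.  For n ≥ 2 and σ of length n, the result lies in 𝒫_{n+1}(132) exactly when
-- σ ∈ 𝒫_n(132) and m goes in front, in second position with σ(1) the maximum of σ (otherwise
-- σ(1) m c is a 132 for some later c > σ(1)), or at the end: after two entries a b and before
-- a third one z, m always completes a 132, 2341 or 3241.  In front m adds a right-to-left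
-- maximum, in second position it changes nothing and at the end it is the only one left.
-- Writing aᵐ_{r,n} for the number of permutations in 𝒫_n(132) that start with n and have r
-- right-to-left maxima, for n ≥ 2
--   a_{r+1,n+1} = a_{r,n} + aᵐ_{r+1,n} + [r = 0] |𝒫_n(132)|,   aᵐ_{r+1,n+1} = a_{r,n},
-- hence a_{r+2,n+2} = a_{r+1,n+1} + a_{r+1,n}, i.e. A_{r+2} = (x + x²) A_{r+1}, which is also
-- how the right-hand side changes from r + 1 to r + 2.  For r = 1, a_{1,n+1} = |𝒫_n(132)|
-- satisfies the Pell recurrence, so (1 - 2x - x²) A_1 = x (1 - x - x²).
module Submission where

open import Defs
open import Data.Bool using (Bool; true; false; T; _∧_)
open import Data.Bool.ListAction using (all)
open import Data.Bool.Properties using (T-≡; ∧-zeroʳ; ∧-identityʳ; ∧-conicalʳ; ∧-assoc)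
open import Data.Integer as ℤ using (ℤ; 0ℤ)
import Data.Integer.Properties as ℤ
open import Data.Integer.Tactic.RingSolver using () renaming (solve-∀ to ℤ-solve)
open import Data.List using (List; []; _∷_; _++_; [_]; map; concatMap; length; filter; applyDownFrom; foldr; upTo)
open import Data.List.Properties
  using (filter-++; length-++; ++-assoc; ++-identityʳ; map-∘; map-cong; map-applyUpTo; map-upTo)
open import Data.List.Membership.Propositional using (_∈_; find; lose)
open import Data.List.Membership.Propositional.Properties using (∈-++⁻; ∈-++⁺ˡ; ∈-++⁺ʳ; ∈-map⁻; ∈-map⁺)
open import Data.List.Relation.Binary.Permutation.Propositional
  using (_↭_; ↭-refl; ↭-prep; ↭-swap; ↭-trans; ↭-sym; ↭⇒↭ₛ)
open import Data.List.Relation.Binary.Permutation.Propositional.Properties using (All-resp-↭; ↭-length)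
open import Data.List.Relation.Binary.Sublist.Propositional
  using (_⊆_; []; _∷_; _∷ʳ_; minimum; ⊆-refl; ⊆-trans; from∈)
open import Data.List.Relation.Binary.Sublist.Propositional.Properties using (++⁺; All-resp-⊆)
open import Data.List.Relation.Unary.All as All using (All; []; _∷_)
open import Data.List.Relation.Unary.All.Properties
  using (all⁺; all⁻; ¬All⇒Any¬; map⁺; concat⁺; applyDownFrom⁺₁)
open import Data.List.Relation.Unary.AllPairs using (_∷_)
open import Data.List.Relation.Unary.Any using (here)
open import Data.List.Relation.Unary.Any.Properties using (any⁺; any⁻)
open import Data.List.Relation.Unary.Unique.Propositional using (Unique)
import Data.List.Relation.Unary.Unique.Propositional.Properties as Unique
open import Data.Nat using (ℕ; zero; suc; _+_; _*_; _∸_; _≤_; _<_; _<ᵇ_; _≡ᵇ_; s≤s; _<?_)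
open import Data.Nat.Properties
  using ( <ᵇ⇒<; <⇒<ᵇ; ≮⇒≥; ≤⇒≯; <⇒≱; <-asym; <⇒≤; ≤-trans; <-trans; <-≤-trans; ≤-<-trans
        ; ≤∧≢⇒<; <⇒≢; +-assoc; +-identityʳ; m≤n⇒∃[o]m+o≡n)
open import Data.Nat.Tactic.RingSolver using (solve-∀)
open import Data.Product using (_×_; _,_; ∃-syntax; ∃₂)
open import Data.Sum using (_⊎_; inj₁; inj₂)
open import Function using (_∘_; Equivalence)
open import Relation.Nullary using (yes; no; contradiction)
open import Relation.Nullary.Decidable using (T?)
open import Relation.Binary.PropositionalEquality
  using (_≡_; _≢_; _≗_; refl; sym; trans; cong; cong₂; subst; setoid; module ≡-Reasoning)
open import Data.List.Relation.Binary.Permutation.Setoid.Properties (setoid ℕ) using (Unique-resp-↭)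

<ᵇ≡true⇒< : ∀ {m n} → (m <ᵇ n) ≡ true → m < n
<ᵇ≡true⇒< {m} {n} e = <ᵇ⇒< m n (Equivalence.from T-≡ e)

<ᵇ≡false⇒≥ : ∀ {m n} → (m <ᵇ n) ≡ false → n ≤ m
<ᵇ≡false⇒≥ e = ≮⇒≥ (λ m<n → subst T e (<⇒<ᵇ m<n))

<⇒<ᵇ≡true : ∀ {m n} → m < n → (m <ᵇ n) ≡ true
<⇒<ᵇ≡true = Equivalence.to T-≡ ∘ <⇒<ᵇ

≥⇒<ᵇ≡false : ∀ {m n} → n ≤ m → (m <ᵇ n) ≡ false
≥⇒<ᵇ≡false {m} {n} n≤m with m <ᵇ n in e
... | false = refl
... | true  = contradiction (<ᵇ≡true⇒< e) (≤⇒≯ n≤m)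

∈-subseqs⁻ : ∀ k π {s} → s ∈ subseqs k π → s ⊆ π
∈-subseqs⁻ zero    π       (here refl) = minimum π
∈-subseqs⁻ (suc k) (x ∷ π) s∈ with ∈-++⁻ (map (x ∷_) (subseqs k π)) s∈
... | inj₁ s∈map with ∈-map⁻ (x ∷_) s∈map
...   | s′ , s′∈ , refl = refl ∷ ∈-subseqs⁻ k π s′∈
∈-subseqs⁻ (suc k) (x ∷ π) s∈ | inj₂ s∈rest = x ∷ʳ ∈-subseqs⁻ (suc k) π s∈rest

∈-subseqs⁺ : ∀ {s π} → s ⊆ π → s ∈ subseqs (length s) π
∈-subseqs⁺ []                   = here refl
∈-subseqs⁺ {[]}    (y ∷ʳ s⊆π)   = here refl
∈-subseqs⁺ {_ ∷ _} (y ∷ʳ s⊆π)   = ∈-++⁺ʳ (map (y ∷_) _) (∈-subseqs⁺ s⊆π)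
∈-subseqs⁺         (refl ∷ s⊆π) = ∈-++⁺ˡ (∈-map⁺ (_ ∷_) (∈-subseqs⁺ s⊆π))

orderIso-length : ∀ σ s → orderIso σ s ≡ true → length σ ≡ length s
orderIso-length []      []      _ = refl
orderIso-length (x ∷ σ) (u ∷ s) e = cong suc (orderIso-length σ s (∧-conicalʳ _ _ e))

contains⁻ : ∀ σ π → contains σ π ≡ true → ∃[ s ] s ⊆ π × orderIso σ s ≡ true
contains⁻ σ π e with find (any⁻ (orderIso σ) _ (Equivalence.from T-≡ e))
... | s , s∈ , iso = s , ∈-subseqs⁻ (length σ) π s∈ , Equivalence.to T-≡ iso

contains⁺ : ∀ σ {π s} → s ⊆ π → orderIso σ s ≡ true → contains σ π ≡ true
contains⁺ σ {π} {s} s⊆π iso = Equivalence.to T-≡ (any⁺ (orderIso σ) (lose s∈ (Equivalence.from T-≡ iso)))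
  where
  s∈ : s ∈ subseqs (length σ) π
  s∈ = subst (λ k → s ∈ subseqs k π) (sym (orderIso-length σ s iso)) (∈-subseqs⁺ s⊆π)

-- orderIso compares entries with _<ᵇ_ only, so a tie reads as a descent: hence the ≤'s.
data Occurrence (π : List ℕ) : Set where
  occ132  : ∀ {a b c}   → a ∷ b ∷ c ∷ [] ⊆ π     → a < c → c ≤ b         → Occurrence π
  occ2341 : ∀ {a b c d} → a ∷ b ∷ c ∷ d ∷ [] ⊆ π → d ≤ a → a < b → b < c → Occurrence π
  occ3241 : ∀ {a b c d} → a ∷ b ∷ c ∷ d ∷ [] ⊆ π → d ≤ b → b ≤ a → a < c → Occurrence π

orderIso-132⁻ : ∀ a b c → orderIso p132 (a ∷ b ∷ c ∷ []) ≡ true → a < c × c ≤ b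
orderIso-132⁻ a b c h with a <ᵇ b | a <ᵇ c in ac | b <ᵇ c in bc | h
... | true  | true  | false | _  = <ᵇ≡true⇒< ac , <ᵇ≡false⇒≥ bc
... | true  | true  | true  | ()
... | true  | false | _     | ()
... | false | _     | _     | ()

orderIso-2341⁻ : ∀ a b c d → orderIso p2341 (a ∷ b ∷ c ∷ d ∷ []) ≡ true → d ≤ a × a < b × b < c
orderIso-2341⁻ a b c d h with a <ᵇ b in ab | a <ᵇ c | a <ᵇ d in ad | b <ᵇ c in bc | h
... | true  | true  | false | true  | _  = <ᵇ≡false⇒≥ ad , <ᵇ≡true⇒< ab , <ᵇ≡true⇒< bc
... | true  | true  | false | false | ()
... | true  | true  | true  | _     | ()
... | true  | false | _     | _     | ()
... | false | _     | _     | _     | ()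

orderIso-3241⁻ : ∀ a b c d → orderIso p3241 (a ∷ b ∷ c ∷ d ∷ []) ≡ true → d ≤ b × b ≤ a × a < c
orderIso-3241⁻ a b c d h with a <ᵇ b in ab | a <ᵇ c in ac | a <ᵇ d | b <ᵇ c | b <ᵇ d in bd | h
... | false | true  | false | true  | false | _  = <ᵇ≡false⇒≥ bd , <ᵇ≡false⇒≥ ab , <ᵇ≡true⇒< ac
... | false | true  | false | true  | true  | ()
... | false | true  | false | false | _     | ()
... | false | true  | true  | _     | _     | ()
... | false | false | _     | _     | _     | ()
... | true  | _     | _     | _     | _     | ()

orderIso-132⁺ : ∀ {a b c} → a < c → c ≤ b → orderIso p132 (a ∷ b ∷ c ∷ []) ≡ true
orderIso-132⁺ a<c c≤b
  rewrite <⇒<ᵇ≡true (<-≤-trans a<c c≤b) | <⇒<ᵇ≡true a<c | ≥⇒<ᵇ≡false c≤b = refl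

orderIso-2341⁺ : ∀ {a b c d} → d ≤ a → a < b → b < c → orderIso p2341 (a ∷ b ∷ c ∷ d ∷ []) ≡ true
orderIso-2341⁺ d≤a a<b b<c
  rewrite <⇒<ᵇ≡true a<b | <⇒<ᵇ≡true (<-trans a<b b<c) | ≥⇒<ᵇ≡false d≤a | <⇒<ᵇ≡true b<c
        | ≥⇒<ᵇ≡false (≤-trans d≤a (<⇒≤ a<b)) | ≥⇒<ᵇ≡false (≤-trans d≤a (<⇒≤ (<-trans a<b b<c))) = refl

orderIso-3241⁺ : ∀ {a b c d} → d ≤ b → b ≤ a → a < c → orderIso p3241 (a ∷ b ∷ c ∷ d ∷ []) ≡ true
orderIso-3241⁺ d≤b b≤a a<c
  rewrite ≥⇒<ᵇ≡false b≤a | <⇒<ᵇ≡true a<c | ≥⇒<ᵇ≡false (≤-trans d≤b b≤a) | <⇒<ᵇ≡true (≤-<-trans b≤a a<c)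
        | ≥⇒<ᵇ≡false d≤b | ≥⇒<ᵇ≡false (≤-trans (≤-trans d≤b b≤a) (<⇒≤ a<c)) = refl

sublist-132⇒occurrence : ∀ {π} s → s ⊆ π → orderIso p132 s ≡ true → Occurrence π
sublist-132⇒occurrence (a ∷ b ∷ c ∷ []) s⊆π iso =
  let a<c , c≤b = orderIso-132⁻ a b c iso in occ132 s⊆π a<c c≤b
sublist-132⇒occurrence s@[]                    _ iso = contradiction (orderIso-length p132 s iso) λ ()
sublist-132⇒occurrence s@(_ ∷ [])              _ iso = contradiction (orderIso-length p132 s iso) λ ()
sublist-132⇒occurrence s@(_ ∷ _ ∷ [])          _ iso = contradiction (orderIso-length p132 s iso) λ ()
sublist-132⇒occurrence s@(_ ∷ _ ∷ _ ∷ _ ∷ _)   _ iso = contradiction (orderIso-length p132 s iso) λ ()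

sublist-2341⇒occurrence : ∀ {π} s → s ⊆ π → orderIso p2341 s ≡ true → Occurrence π
sublist-2341⇒occurrence (a ∷ b ∷ c ∷ d ∷ []) s⊆π iso =
  let d≤a , a<b , b<c = orderIso-2341⁻ a b c d iso in occ2341 s⊆π d≤a a<b b<c
sublist-2341⇒occurrence s@[]                      _ iso = contradiction (orderIso-length p2341 s iso) λ ()
sublist-2341⇒occurrence s@(_ ∷ [])                _ iso = contradiction (orderIso-length p2341 s iso) λ ()
sublist-2341⇒occurrence s@(_ ∷ _ ∷ [])            _ iso = contradiction (orderIso-length p2341 s iso) λ ()
sublist-2341⇒occurrence s@(_ ∷ _ ∷ _ ∷ [])        _ iso = contradiction (orderIso-length p2341 s iso) λ ()
sublist-2341⇒occurrence s@(_ ∷ _ ∷ _ ∷ _ ∷ _ ∷ _) _ iso = contradiction (orderIso-length p2341 s iso) λ ()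

sublist-3241⇒occurrence : ∀ {π} s → s ⊆ π → orderIso p3241 s ≡ true → Occurrence π
sublist-3241⇒occurrence (a ∷ b ∷ c ∷ d ∷ []) s⊆π iso =
  let d≤b , b≤a , a<c = orderIso-3241⁻ a b c d iso in occ3241 s⊆π d≤b b≤a a<c
sublist-3241⇒occurrence s@[]                      _ iso = contradiction (orderIso-length p3241 s iso) λ ()
sublist-3241⇒occurrence s@(_ ∷ [])                _ iso = contradiction (orderIso-length p3241 s iso) λ ()
sublist-3241⇒occurrence s@(_ ∷ _ ∷ [])            _ iso = contradiction (orderIso-length p3241 s iso) λ ()
sublist-3241⇒occurrence s@(_ ∷ _ ∷ _ ∷ [])        _ iso = contradiction (orderIso-length p3241 s iso) λ ()
sublist-3241⇒occurrence s@(_ ∷ _ ∷ _ ∷ _ ∷ _ ∷ _) _ iso = contradiction (orderIso-length p3241 s iso) λ ()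

inP132≡false⇒occurrence : ∀ π → inP132 π ≡ false → Occurrence π
inP132≡false⇒occurrence π h
  with contains p132 π in e₁ | contains p2341 π in e₂ | contains p3241 π in e₃
... | true  | _     | _    = let s , s⊆π , iso = contains⁻ p132 π e₁ in sublist-132⇒occurrence s s⊆π iso
... | false | true  | _    = let s , s⊆π , iso = contains⁻ p2341 π e₂ in sublist-2341⇒occurrence s s⊆π iso
... | false | false | true = let s , s⊆π , iso = contains⁻ p3241 π e₃ in sublist-3241⇒occurrence s s⊆π iso

occurrence⇒inP132≡false : ∀ {π} → Occurrence π → inP132 π ≡ false
occurrence⇒inP132≡false (occ132 s⊆π a<c c≤b)
  rewrite contains⁺ p132 s⊆π (orderIso-132⁺ a<c c≤b) = refl
occurrence⇒inP132≡false {π} (occ2341 s⊆π d≤a a<b b<c)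
  rewrite contains⁺ p2341 s⊆π (orderIso-2341⁺ d≤a a<b b<c) = ∧-zeroʳ (avoids p132 π)
occurrence⇒inP132≡false {π} (occ3241 s⊆π d≤b b≤a a<c)
  rewrite contains⁺ p3241 s⊆π (orderIso-3241⁺ d≤b b≤a a<c) | ∧-zeroʳ (avoids p2341 π) = ∧-zeroʳ (avoids p132 π)

occurrence-⊆ : ∀ {σ π} → σ ⊆ π → Occurrence σ → Occurrence π
occurrence-⊆ σ⊆π (occ132  s⊆σ a<c c≤b)     = occ132  (⊆-trans s⊆σ σ⊆π) a<c c≤b
occurrence-⊆ σ⊆π (occ2341 s⊆σ d≤a a<b b<c) = occ2341 (⊆-trans s⊆σ σ⊆π) d≤a a<b b<c
occurrence-⊆ σ⊆π (occ3241 s⊆σ d≤b b≤a a<c) = occ3241 (⊆-trans s⊆σ σ⊆π) d≤b b≤a a<c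

inP132-cong : ∀ {σ π} → σ ⊆ π → (Occurrence π → Occurrence σ) → inP132 π ≡ inP132 σ
inP132-cong {σ} {π} σ⊆π reflect with inP132 σ in eσ | inP132 π in eπ
... | true  | true  = refl
... | false | false = refl
... | false | true  =
  contradiction (trans (sym eπ) (occurrence⇒inP132≡false (occurrence-⊆ σ⊆π (inP132≡false⇒occurrence σ eσ)))) λ ()
... | true  | false =
  contradiction (trans (sym eσ) (occurrence⇒inP132≡false (reflect (inP132≡false⇒occurrence π eπ)))) λ ()

⊆-split : ∀ (pre : List ℕ) {m suf s} → s ⊆ pre ++ m ∷ suf →
  s ⊆ pre ++ suf ⊎ ∃₂ λ s₁ s₂ → s ≡ s₁ ++ m ∷ s₂ × s₁ ⊆ pre × s₂ ⊆ suf
⊆-split []        (_ ∷ʳ s⊆)   = inj₁ s⊆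
⊆-split []        (refl ∷ s⊆) = inj₂ ([] , _ , refl , [] , s⊆)
⊆-split (x ∷ pre) (_ ∷ʳ s⊆) with ⊆-split pre s⊆
... | inj₁ s⊆′                          = inj₁ (x ∷ʳ s⊆′)
... | inj₂ (s₁ , s₂ , refl , s₁⊆ , s₂⊆) = inj₂ (s₁ , s₂ , refl , x ∷ʳ s₁⊆ , s₂⊆)
⊆-split (x ∷ pre) (refl ∷ s⊆) with ⊆-split pre s⊆
... | inj₁ s⊆′                          = inj₁ (refl ∷ s⊆′)
... | inj₂ (s₁ , s₂ , refl , s₁⊆ , s₂⊆) = inj₂ (x ∷ s₁ , s₂ , refl , refl ∷ s₁⊆ , s₂⊆)

-- What an occurrence through an inserted maximum m leaves on either side of m: m is its
-- largest letter, the 3 of a 132 or the 4 of a 2341 or a 3241.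
data UsesMax (pre suf : List ℕ) : Set where
  max-is-3 : ∀ {a c}   → [ a ] ⊆ pre     → [ c ] ⊆ suf → a < c → UsesMax pre suf
  max-is-4 : ∀ {a b d} → a ∷ b ∷ [] ⊆ pre → [ d ] ⊆ suf         → UsesMax pre suf

module _ {pre suf m} (<pre : All (_< m) pre) (<suf : All (_< m) suf) where

  usesMax-132 : ∀ {a b c} s₁ {s₂} → a ∷ b ∷ c ∷ [] ≡ s₁ ++ m ∷ s₂ → s₁ ⊆ pre → s₂ ⊆ suf →
    a < c → c ≤ b → UsesMax pre suf
  usesMax-132 []           refl _   s₂⊆ a<c _ with All-resp-⊆ s₂⊆ <suf
  ... | _ ∷ c<m ∷ [] = contradiction a<c (<-asym c<m)
  usesMax-132 (_ ∷ [])     refl s₁⊆ s₂⊆ a<c _ = max-is-3 s₁⊆ s₂⊆ a<c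
  usesMax-132 (_ ∷ _ ∷ []) refl s₁⊆ _   _   c≤b with All-resp-⊆ s₁⊆ <pre
  ... | _ ∷ b<m ∷ [] = contradiction c≤b (<⇒≱ b<m)
  usesMax-132 (_ ∷ _ ∷ _ ∷ [])    () _ _ _ _
  usesMax-132 (_ ∷ _ ∷ _ ∷ _ ∷ _) () _ _ _ _

  usesMax-2341 : ∀ {a b c d} s₁ {s₂} → a ∷ b ∷ c ∷ d ∷ [] ≡ s₁ ++ m ∷ s₂ → s₁ ⊆ pre → s₂ ⊆ suf →
    d ≤ a → a < b → b < c → UsesMax pre suf
  usesMax-2341 []               refl _   s₂⊆ _   a<b _ with All-resp-⊆ s₂⊆ <suf
  ... | b<m ∷ _ = contradiction a<b (<-asym b<m)
  usesMax-2341 (_ ∷ [])         refl _   s₂⊆ _   _   b<c with All-resp-⊆ s₂⊆ <suf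
  ... | c<m ∷ _ = contradiction b<c (<-asym c<m)
  usesMax-2341 (_ ∷ _ ∷ [])     refl s₁⊆ s₂⊆ _   _   _ = max-is-4 s₁⊆ s₂⊆
  usesMax-2341 (_ ∷ _ ∷ _ ∷ []) refl s₁⊆ _   d≤a _   _ with All-resp-⊆ s₁⊆ <pre
  ... | a<m ∷ _ = contradiction d≤a (<⇒≱ a<m)
  usesMax-2341 (_ ∷ _ ∷ _ ∷ _ ∷ [])    () _ _ _ _ _
  usesMax-2341 (_ ∷ _ ∷ _ ∷ _ ∷ _ ∷ _) () _ _ _ _ _

  usesMax-3241 : ∀ {a b c d} s₁ {s₂} → a ∷ b ∷ c ∷ d ∷ [] ≡ s₁ ++ m ∷ s₂ → s₁ ⊆ pre → s₂ ⊆ suf →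
    d ≤ b → b ≤ a → a < c → UsesMax pre suf
  usesMax-3241 []               refl _   s₂⊆ _   _   a<c with All-resp-⊆ s₂⊆ <suf
  ... | _ ∷ c<m ∷ _ = contradiction a<c (<-asym c<m)
  usesMax-3241 (_ ∷ [])         refl _   s₂⊆ _   b≤a a<c with All-resp-⊆ s₂⊆ <suf
  ... | c<m ∷ _ = contradiction (≤-<-trans b≤a a<c) (<-asym c<m)
  usesMax-3241 (_ ∷ _ ∷ [])     refl s₁⊆ s₂⊆ _   _   _ = max-is-4 s₁⊆ s₂⊆
  usesMax-3241 (_ ∷ _ ∷ _ ∷ []) refl s₁⊆ _   d≤b b≤a _ with All-resp-⊆ s₁⊆ <pre
  ... | a<m ∷ _ = contradiction (≤-trans d≤b b≤a) (<⇒≱ a<m)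
  usesMax-3241 (_ ∷ _ ∷ _ ∷ _ ∷ [])    () _ _ _ _ _
  usesMax-3241 (_ ∷ _ ∷ _ ∷ _ ∷ _ ∷ _) () _ _ _ _ _

  occurrence-insertMax : Occurrence (pre ++ m ∷ suf) → Occurrence (pre ++ suf) ⊎ UsesMax pre suf
  occurrence-insertMax (occ132 s⊆ a<c c≤b) with ⊆-split pre s⊆
  ... | inj₁ s⊆′                          = inj₁ (occ132 s⊆′ a<c c≤b)
  ... | inj₂ (s₁ , _ , eq , s₁⊆ , s₂⊆)    = inj₂ (usesMax-132 s₁ eq s₁⊆ s₂⊆ a<c c≤b)
  occurrence-insertMax (occ2341 s⊆ d≤a a<b b<c) with ⊆-split pre s⊆
  ... | inj₁ s⊆′                          = inj₁ (occ2341 s⊆′ d≤a a<b b<c)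
  ... | inj₂ (s₁ , _ , eq , s₁⊆ , s₂⊆)    = inj₂ (usesMax-2341 s₁ eq s₁⊆ s₂⊆ d≤a a<b b<c)
  occurrence-insertMax (occ3241 s⊆ d≤b b≤a a<c) with ⊆-split pre s⊆
  ... | inj₁ s⊆′                          = inj₁ (occ3241 s⊆′ d≤b b≤a a<c)
  ... | inj₂ (s₁ , _ , eq , s₁⊆ , s₂⊆)    = inj₂ (usesMax-3241 s₁ eq s₁⊆ s₂⊆ d≤b b≤a a<c)

inP132-max∷ : ∀ {m} σ → All (_< m) σ → inP132 (m ∷ σ) ≡ inP132 σ
inP132-max∷ {m} σ <σ = inP132-cong (m ∷ʳ ⊆-refl) reflect
  where
  reflect : Occurrence (m ∷ σ) → Occurrence σ
  reflect o with occurrence-insertMax [] <σ o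
  ... | inj₁ o′                = o′
  ... | inj₂ (max-is-3 () _ _)
  ... | inj₂ (max-is-4 () _)

inP132-∷ʳmax : ∀ {m} σ → All (_< m) σ → inP132 (σ ++ [ m ]) ≡ inP132 σ
inP132-∷ʳmax {m} σ <σ =
  trans (inP132-cong (++⁺ ⊆-refl (minimum [ m ])) reflect) (cong inP132 (++-identityʳ σ))
  where
  reflect : Occurrence (σ ++ [ m ]) → Occurrence (σ ++ [])
  reflect o with occurrence-insertMax <σ [] o
  ... | inj₁ o′                = o′
  ... | inj₂ (max-is-3 _ () _)
  ... | inj₂ (max-is-4 _ ())

inP132-insertSecond : ∀ {m x} xs → x < m → All (_< m) xs → All (x ≢_) xs →
  inP132 (x ∷ m ∷ xs) ≡ inP132 (x ∷ xs) ∧ all (_<ᵇ x) xs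
inP132-insertSecond {m} {x} xs x<m <xs x∉xs with all (_<ᵇ x) xs in e
... | true = trans (inP132-cong (refl ∷ m ∷ʳ ⊆-refl) reflect) (sym (∧-identityʳ _))
  where
  xs<x : All (_< x) xs
  xs<x = All.map (λ {c} → <ᵇ⇒< c x) (all⁺ (_<ᵇ x) xs (Equivalence.from T-≡ e))
  reflect : Occurrence (x ∷ m ∷ xs) → Occurrence (x ∷ xs)
  reflect o with occurrence-insertMax (x<m ∷ []) <xs o
  ... | inj₁ o′                               = o′
  ... | inj₂ (max-is-3 (refl ∷ []) c⊆ x<c) with All-resp-⊆ c⊆ xs<x
  ...   | c<x ∷ [] = contradiction x<c (<-asym c<x)
  reflect o | inj₂ (max-is-3 (_ ∷ʳ ()) _ _)
  reflect o | inj₂ (max-is-4 (_ ∷ʳ ()) _)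
  reflect o | inj₂ (max-is-4 (_ ∷ ()) _)
... | false with find (¬All⇒Any¬ (T? ∘ (_<ᵇ x)) xs (λ xs<x → subst T e (all⁻ (_<ᵇ x) xs<x)))
...   | c , c∈xs , c≮x = trans (occurrence⇒inP132≡false x⋯m⋯c) (sym (∧-zeroʳ _))
  where
  x<c : x < c
  x<c = ≤∧≢⇒< (≮⇒≥ (c≮x ∘ <⇒<ᵇ)) (All.lookup x∉xs c∈xs)
  x⋯m⋯c : Occurrence (x ∷ m ∷ xs)
  x⋯m⋯c = occ132 (refl ∷ refl ∷ from∈ c∈xs) x<c (<⇒≤ (All.lookup <xs c∈xs))

inP132-interior : ∀ {m a b z} rest zs → a < m → b < m → z < m →
  inP132 (a ∷ b ∷ rest ++ m ∷ z ∷ zs) ≡ false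
inP132-interior {m} {a} {b} {z} rest zs a<m b<m z<m = occurrence⇒inP132≡false occurrence
  where
  m,z⊆ : m ∷ z ∷ [] ⊆ rest ++ m ∷ z ∷ zs
  m,z⊆ = ++⁺ (minimum rest) (refl ∷ refl ∷ minimum zs)
  occurrence : Occurrence (a ∷ b ∷ rest ++ m ∷ z ∷ zs)
  occurrence with a <? b | a <? z | b <? z
  ... | yes a<b | yes a<z | _       = occ132 (refl ∷ b ∷ʳ m,z⊆) a<z (<⇒≤ z<m)
  ... | yes a<b | no  a≮z | _       = occ2341 (refl ∷ refl ∷ m,z⊆) (≮⇒≥ a≮z) a<b b<m
  ... | no  a≮b | _       | yes b<z = occ132 (a ∷ʳ refl ∷ m,z⊆) b<z (<⇒≤ z<m)
  ... | no  a≮b | _       | no  b≮z = occ3241 (refl ∷ refl ∷ m,z⊆) (≮⇒≥ b≮z) (≮⇒≥ a≮b) a<m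

insertions-↭ : ∀ x ys → All (_↭ x ∷ ys) (insertions x ys)
insertions-↭ x []       = ↭-refl ∷ []
insertions-↭ x (y ∷ ys) =
  ↭-refl ∷ map⁺ (All.map (λ τ↭ → ↭-trans (↭-prep y τ↭) (↭-swap y x ↭-refl)) (insertions-↭ x ys))

perms-↭ : ∀ n → All (_↭ applyDownFrom suc n) (perms n)
perms-↭ zero    = ↭-refl ∷ []
perms-↭ (suc n) = concat⁺ (map⁺ (All.map extend (perms-↭ n)))
  where
  extend : ∀ {σ} → σ ↭ applyDownFrom suc n → All (_↭ applyDownFrom suc (suc n)) (insertions (suc n) σ)
  extend {σ} σ↭ = All.map (λ τ↭ → ↭-trans τ↭ (↭-prep (suc n) σ↭)) (insertions-↭ (suc n) σ)

↭-range⇒< : ∀ {n σ} → σ ↭ applyDownFrom suc n → All (_< suc n) σ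
↭-range⇒< {n} σ↭ = All-resp-↭ (↭-sym σ↭) (applyDownFrom⁺₁ suc n s≤s)

↭-range⇒unique : ∀ {n σ} → σ ↭ applyDownFrom suc n → Unique σ
↭-range⇒unique {n} σ↭ =
  Unique-resp-↭ (↭⇒↭ₛ (↭-sym σ↭)) (Unique.applyDownFrom⁺₁ suc n (λ j<i _ → <⇒≢ (s≤s j<i) ∘ sym))

headIsMax : List ℕ → Bool
headIsMax []       = false
headIsMax (x ∷ xs) = all (_<ᵇ x) xs

insertSecond : ℕ → List ℕ → List ℕ
insertSecond m []       = [ m ]
insertSecond m (x ∷ xs) = x ∷ m ∷ xs

all-<ᵇ : ∀ {m} σ → All (_< m) σ → all (_<ᵇ m) σ ≡ true
all-<ᵇ {m} σ <σ = Equivalence.to T-≡ (all⁻ (_<ᵇ m) (All.map <⇒<ᵇ <σ))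

headIsMax-insertSecond : ∀ {m x} xs → x < m → headIsMax (x ∷ m ∷ xs) ≡ false
headIsMax-insertSecond xs x<m rewrite ≥⇒<ᵇ≡false (<⇒≤ x<m) = refl

headIsMax-∷ʳmax : ∀ {m x} σ → x < m → headIsMax (x ∷ σ ++ [ m ]) ≡ false
headIsMax-∷ʳmax []      x<m rewrite ≥⇒<ᵇ≡false (<⇒≤ x<m) = refl
headIsMax-∷ʳmax (y ∷ σ) x<m rewrite headIsMax-∷ʳmax σ x<m = ∧-zeroʳ _

rlMax-max∷ : ∀ {m} σ → All (_< m) σ → rlMax (m ∷ σ) ≡ suc (rlMax σ)
rlMax-max∷ σ <σ rewrite all-<ᵇ σ <σ = refl

rlMax-insertSecond : ∀ {m x} xs → x < m → All (_< m) xs → headIsMax (x ∷ xs) ≡ true →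
  rlMax (x ∷ m ∷ xs) ≡ rlMax (x ∷ xs)
rlMax-insertSecond xs x<m <xs x-max rewrite ≥⇒<ᵇ≡false (<⇒≤ x<m) | all-<ᵇ xs <xs | x-max = refl

rlMax-∷ʳmax : ∀ {m} σ → All (_< m) σ → rlMax (σ ++ [ m ]) ≡ 1
rlMax-∷ʳmax []      []          = refl
rlMax-∷ʳmax (x ∷ σ) (x<m ∷ <σ) rewrite headIsMax-∷ʳmax σ x<m = rlMax-∷ʳmax σ <σ

rlMax-nonzero : ∀ x xs → (rlMax (x ∷ xs) ≡ᵇ 0) ≡ false
rlMax-nonzero x []       = refl
rlMax-nonzero x (y ∷ ys) with all (_<ᵇ x) (y ∷ ys)
... | true  = refl
... | false = rlMax-nonzero y ys

private variable U V : Set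

count : (U → Bool) → List U → ℕ
count p = length ∘ filter (T? ∘ p)

count-++ : ∀ (p : U → Bool) xs ys → count p (xs ++ ys) ≡ count p xs + count p ys
count-++ p xs ys = trans (cong length (filter-++ (T? ∘ p) xs ys)) (length-++ (filter (T? ∘ p) xs))

count-[-]-cong : ∀ (p q : U → Bool) {x y} → p x ≡ q y → count p [ x ] ≡ count q [ y ]
count-[-]-cong p q {x} {y} e with p x | q y
... | true  | true  = refl
... | false | false = refl
... | true  | false = contradiction e λ ()
... | false | true  = contradiction e λ ()

count-congᴬ : ∀ {p q : U → Bool} {xs} → All (λ x → p x ≡ q x) xs → count p xs ≡ count q xs
count-congᴬ                      []       = refl
count-congᴬ {p = p} {q} {x ∷ xs} (e ∷ es) =
  trans (count-++ p [ x ] xs) (trans (cong₂ _+_ (count-[-]-cong p q e) (count-congᴬ es)) (sym (count-++ q [ x ] xs)))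

count-false : ∀ {p : U → Bool} {xs} → All (λ x → p x ≡ false) xs → count p xs ≡ 0
count-false {xs = xs} es = trans (count-congᴬ {q = λ _ → false} es) (count-const-false xs)
  where
  count-const-false : ∀ xs → count (λ _ → false) xs ≡ 0
  count-const-false []       = refl
  count-const-false (_ ∷ xs) = count-const-false xs

count-∷-∷ : ∀ (p : U → Bool) x y zs → count p (x ∷ y ∷ zs) ≡ count p [ x ] + count p [ y ] + count p zs
count-∷-∷ p x y zs =
  trans (count-++ p [ x ] (y ∷ zs)) (trans (cong (count p [ x ] +_) (count-++ p [ y ] zs)) (sym (+-assoc (count p [ x ]) _ _)))

count-reject : ∀ {p : U → Bool} {x} xs → p x ≡ false → count p (x ∷ xs) ≡ count p xs
count-reject {p = p} {x} xs e with p x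
... | false = refl

count-concatMap₃ : ∀ {P : U → Set} {p : V → Bool} {q₁ q₂ q₃ : U → Bool} (F : U → List V) →
  (∀ {x} → P x → count p (F x) ≡ count q₁ [ x ] + count q₂ [ x ] + count q₃ [ x ]) →
  ∀ {xs} → All P xs → count p (concatMap F xs) ≡ count q₁ xs + count q₂ xs + count q₃ xs
count-concatMap₃ F split [] = refl
count-concatMap₃ {p = p} {q₁} {q₂} {q₃} F split {x ∷ xs} (px ∷ pxs) = begin
  count p (F x ++ concatMap F xs)
    ≡⟨ count-++ p (F x) (concatMap F xs) ⟩
  count p (F x) + count p (concatMap F xs)
    ≡⟨ cong₂ _+_ (split px) (count-concatMap₃ F split pxs) ⟩
  (count q₁ [ x ] + count q₂ [ x ] + count q₃ [ x ]) + (count q₁ xs + count q₂ xs + count q₃ xs)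
    ≡⟨ +-interchange₃ (count q₁ [ x ]) _ _ _ _ _ ⟩
  (count q₁ [ x ] + count q₁ xs) + (count q₂ [ x ] + count q₂ xs) + (count q₃ [ x ] + count q₃ xs)
    ≡⟨ sym (cong₂ _+_ (cong₂ _+_ (count-++ q₁ [ x ] xs) (count-++ q₂ [ x ] xs)) (count-++ q₃ [ x ] xs)) ⟩
  count q₁ (x ∷ xs) + count q₂ (x ∷ xs) + count q₃ (x ∷ xs) ∎
  where
  open ≡-Reasoning
  +-interchange₃ : ∀ a b c d e f → (a + b + c) + (d + e + f) ≡ (a + d) + (b + e) + (c + f)
  +-interchange₃ = solve-∀

inP132∧ : (List ℕ → Bool) → List ℕ → Bool
inP132∧ g π = inP132 π ∧ g π

count-interiorInsertions : ∀ g {m a b} rest zs → a < m → b < m → All (_< m) zs →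
  count (inP132∧ g) (map ((a ∷ b ∷ rest) ++_) (insertions m zs)) ≡ count (inP132∧ g) [ a ∷ b ∷ rest ++ zs ++ [ m ] ]
count-interiorInsertions g rest [] a<m b<m [] = refl
count-interiorInsertions g {m} {a} {b} rest (z ∷ zs) a<m b<m (z<m ∷ <zs) = begin
  count (inP132∧ g) ((pre ++ m ∷ z ∷ zs) ∷ map (pre ++_) (map (z ∷_) (insertions m zs)))
    ≡⟨ count-reject {p = inP132∧ g} _ (cong (_∧ g (pre ++ m ∷ z ∷ zs)) (inP132-interior rest zs a<m b<m z<m)) ⟩
  count (inP132∧ g) (map (pre ++_) (map (z ∷_) (insertions m zs)))
    ≡⟨ cong (count (inP132∧ g)) (trans (sym (map-∘ (insertions m zs))) (map-cong (λ τ → sym (++-assoc pre [ z ] τ)) _)) ⟩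
  count (inP132∧ g) (map ((pre ++ [ z ]) ++_) (insertions m zs))
    ≡⟨ count-interiorInsertions g (rest ++ [ z ]) zs a<m b<m <zs ⟩
  count (inP132∧ g) [ a ∷ b ∷ (rest ++ [ z ]) ++ zs ++ [ m ] ]
    ≡⟨ cong (λ l → count (inP132∧ g) [ a ∷ b ∷ l ]) (++-assoc rest [ z ] (zs ++ [ m ])) ⟩
  count (inP132∧ g) [ a ∷ b ∷ rest ++ z ∷ zs ++ [ m ] ] ∎
  where
  open ≡-Reasoning
  pre = a ∷ b ∷ rest

count-insertions : ∀ g {m x y} ys → All (_< m) (x ∷ y ∷ ys) → All (x ≢_) (y ∷ ys) →
  count (inP132∧ g) (insertions m (x ∷ y ∷ ys))
    ≡ count (inP132∧ (g ∘ (m ∷_))) [ x ∷ y ∷ ys ]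
    + count (inP132∧ (λ σ → headIsMax σ ∧ g (insertSecond m σ))) [ x ∷ y ∷ ys ]
    + count (inP132∧ (g ∘ (_++ [ m ]))) [ x ∷ y ∷ ys ]
count-insertions g {m} {x} {y} ys <σ@(x<m ∷ y<m ∷ <ys) x∉ = begin
  count (inP132∧ g) ((m ∷ σ) ∷ (x ∷ m ∷ y ∷ ys) ∷ tail)
    ≡⟨ count-∷-∷ (inP132∧ g) (m ∷ σ) (x ∷ m ∷ y ∷ ys) tail ⟩
  count (inP132∧ g) [ m ∷ σ ] + count (inP132∧ g) [ x ∷ m ∷ y ∷ ys ] + count (inP132∧ g) tail
    ≡⟨ cong₂ _+_ (cong₂ _+_ (count-[-]-cong (inP132∧ g) Q₁ {y = σ} front)
                            (count-[-]-cong (inP132∧ g) Q₂ {y = σ} second))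
                 (trans last (count-[-]-cong (inP132∧ g) Q₃ {σ ++ [ m ]} {σ} end)) ⟩
  count Q₁ [ σ ] + count Q₂ [ σ ] + count Q₃ [ σ ] ∎
  where
  open ≡-Reasoning
  σ = x ∷ y ∷ ys
  Q₁ Q₂ Q₃ : List ℕ → Bool
  Q₁ = inP132∧ (g ∘ (m ∷_))
  Q₂ = inP132∧ (λ σ → headIsMax σ ∧ g (insertSecond m σ))
  Q₃ = inP132∧ (g ∘ (_++ [ m ]))
  tail = map (x ∷_) (map (y ∷_) (insertions m ys))
  last : count (inP132∧ g) tail ≡ count (inP132∧ g) [ σ ++ [ m ] ]
  last = trans (cong (count (inP132∧ g)) (sym (map-∘ (insertions m ys)))) (count-interiorInsertions g [] ys x<m y<m <ys)
  front : inP132∧ g (m ∷ σ) ≡ Q₁ σ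
  front = cong (_∧ g (m ∷ σ)) (inP132-max∷ σ <σ)
  end : inP132∧ g (σ ++ [ m ]) ≡ Q₃ σ
  end = cong (_∧ g (σ ++ [ m ])) (inP132-∷ʳmax σ <σ)
  second : inP132∧ g (x ∷ m ∷ y ∷ ys) ≡ Q₂ σ
  second = trans (cong (_∧ g (x ∷ m ∷ y ∷ ys)) (inP132-insertSecond (y ∷ ys) x<m (y<m ∷ <ys) x∉))
                 (∧-assoc (inP132 σ) _ _)

count𝒫 : (List ℕ → Bool) → ℕ → ℕ
count𝒫 g n = count (inP132∧ g) (perms n)

-- n ≥ 2 matters: for σ of length 1 the second and the last position coincide.
count𝒫-suc : ∀ k g → count𝒫 g (3 + k) ≡
    count𝒫 (g ∘ (3 + k ∷_)) (2 + k)
  + count𝒫 (λ σ → headIsMax σ ∧ g (insertSecond (3 + k) σ)) (2 + k)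
  + count𝒫 (g ∘ (_++ [ 3 + k ])) (2 + k)
count𝒫-suc k g = count-concatMap₃ (insertions (3 + k)) split (perms-↭ (2 + k))
  where
  split : ∀ {σ} → σ ↭ applyDownFrom suc (2 + k) → count (inP132∧ g) (insertions (3 + k) σ) ≡
      count (inP132∧ (g ∘ (3 + k ∷_))) [ σ ]
    + count (inP132∧ (λ σ → headIsMax σ ∧ g (insertSecond (3 + k) σ))) [ σ ]
    + count (inP132∧ (g ∘ (_++ [ 3 + k ]))) [ σ ]
  split {x ∷ y ∷ ys} σ↭ with ↭-range⇒unique σ↭
  ... | x∉ ∷ _ = count-insertions g ys (↭-range⇒< σ↭) x∉
  split {[]}         σ↭ = contradiction (↭-length σ↭) λ ()
  split {_ ∷ []}     σ↭ = contradiction (↭-length σ↭) λ ()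

count𝒫-cong : ∀ {g h} n → (∀ {x xs} → All (_< 2 + n) (x ∷ xs) → g (x ∷ xs) ≡ h (x ∷ xs)) →
  count𝒫 g (suc n) ≡ count𝒫 h (suc n)
count𝒫-cong {g} {h} n g≗h = count-congᴬ (All.map pointwise (perms-↭ (suc n)))
  where
  pointwise : ∀ {σ} → σ ↭ applyDownFrom suc (suc n) → inP132∧ g σ ≡ inP132∧ h σ
  pointwise {x ∷ xs} σ↭ = cong (inP132 (x ∷ xs) ∧_) (g≗h (↭-range⇒< σ↭))
  pointwise {[]}     σ↭ = contradiction (↭-length σ↭) λ ()

count𝒫-vanish : ∀ {g} n → (∀ {x xs} → All (_< 2 + n) (x ∷ xs) → g (x ∷ xs) ≡ false) → count𝒫 g (suc n) ≡ 0
count𝒫-vanish {g} n g≡false =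
  trans (count𝒫-cong n g≡false) (count-false (All.universal (λ π → ∧-zeroʳ (inP132 π)) (perms (suc n))))

∧-congˡ-guarded : ∀ b {c d} → (b ≡ true → c ≡ d) → b ∧ c ≡ b ∧ d
∧-congˡ-guarded true  c≡d = c≡d refl
∧-congˡ-guarded false _   = refl

+-identityʳ² : ∀ n → n + 0 + 0 ≡ n
+-identityʳ² n = trans (+-identityʳ (n + 0)) (+-identityʳ n)

aᵐ : ℕ → ℕ → ℕ
aᵐ r = count𝒫 (λ π → headIsMax π ∧ (rlMax π ≡ᵇ r))

∣𝒫∣ ∣𝒫ᵐ∣ : ℕ → ℕ
∣𝒫∣  = count𝒫 (λ _ → true)
∣𝒫ᵐ∣ = count𝒫 headIsMax

a-zero : ∀ n → a 0 (suc n) ≡ 0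
a-zero n = count𝒫-vanish n (λ {x} {xs} _ → rlMax-nonzero x xs)

a-suc : ∀ r k → a (suc r) (3 + k) ≡ a r (2 + k) + aᵐ (suc r) (2 + k) + count𝒫 (λ _ → 0 ≡ᵇ r) (2 + k)
a-suc r k = trans (count𝒫-suc k (λ π → rlMax π ≡ᵇ suc r))
  (cong₂ _+_ (cong₂ _+_ (count𝒫-cong (suc k) front) (count𝒫-cong (suc k) second)) (count𝒫-cong (suc k) end))
  where
  front : ∀ {x xs} → All (_< 3 + k) (x ∷ xs) → (rlMax (3 + k ∷ x ∷ xs) ≡ᵇ suc r) ≡ (rlMax (x ∷ xs) ≡ᵇ r)
  front <σ = cong (_≡ᵇ suc r) (rlMax-max∷ _ <σ)
  second : ∀ {x xs} → All (_< 3 + k) (x ∷ xs) →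
    headIsMax (x ∷ xs) ∧ (rlMax (x ∷ 3 + k ∷ xs) ≡ᵇ suc r) ≡ headIsMax (x ∷ xs) ∧ (rlMax (x ∷ xs) ≡ᵇ suc r)
  second {x} {xs} (x<m ∷ <xs) =
    ∧-congˡ-guarded (headIsMax (x ∷ xs)) (cong (_≡ᵇ suc r) ∘ rlMax-insertSecond xs x<m <xs)
  end : ∀ {x xs} → All (_< 3 + k) (x ∷ xs) → (rlMax (x ∷ xs ++ [ 3 + k ]) ≡ᵇ suc r) ≡ (0 ≡ᵇ r)
  end <σ = cong (_≡ᵇ suc r) (rlMax-∷ʳmax _ <σ)

aᵐ-suc : ∀ r k → aᵐ (suc r) (3 + k) ≡ a r (2 + k)
aᵐ-suc r k = trans (count𝒫-suc k (λ π → headIsMax π ∧ (rlMax π ≡ᵇ suc r)))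
  (trans (cong₂ _+_ (cong₂ _+_ (count𝒫-cong (suc k) front) (count𝒫-vanish (suc k) second)) (count𝒫-vanish (suc k) end))
         (+-identityʳ² (a r (2 + k))))
  where
  front : ∀ {x xs} → All (_< 3 + k) (x ∷ xs) →
    headIsMax (3 + k ∷ x ∷ xs) ∧ (rlMax (3 + k ∷ x ∷ xs) ≡ᵇ suc r) ≡ (rlMax (x ∷ xs) ≡ᵇ r)
  front {x} {xs} <σ rewrite all-<ᵇ (x ∷ xs) <σ = refl
  second : ∀ {x xs} → All (_< 3 + k) (x ∷ xs) →
    headIsMax (x ∷ xs) ∧ (headIsMax (x ∷ 3 + k ∷ xs) ∧ (rlMax (x ∷ 3 + k ∷ xs) ≡ᵇ suc r)) ≡ false
  second {x} {xs} (x<m ∷ _) rewrite headIsMax-insertSecond xs x<m = ∧-zeroʳ (headIsMax (x ∷ xs))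
  end : ∀ {x xs} → All (_< 3 + k) (x ∷ xs) → headIsMax (x ∷ xs ++ [ 3 + k ]) ∧ (rlMax (x ∷ xs ++ [ 3 + k ]) ≡ᵇ suc r) ≡ false
  end {x} {xs} (x<m ∷ _) rewrite headIsMax-∷ʳmax xs x<m = refl

∣𝒫∣-suc : ∀ k → ∣𝒫∣ (3 + k) ≡ ∣𝒫∣ (2 + k) + ∣𝒫ᵐ∣ (2 + k) + ∣𝒫∣ (2 + k)
∣𝒫∣-suc k = trans (count𝒫-suc k (λ _ → true))
  (cong (λ n → ∣𝒫∣ (2 + k) + n + ∣𝒫∣ (2 + k)) (count𝒫-cong (suc k) (λ _ → ∧-identityʳ _)))

∣𝒫ᵐ∣-suc : ∀ k → ∣𝒫ᵐ∣ (3 + k) ≡ ∣𝒫∣ (2 + k)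
∣𝒫ᵐ∣-suc k = trans (count𝒫-suc k headIsMax)
  (trans (cong₂ _+_ (cong₂ _+_ (count𝒫-cong (suc k) front) (count𝒫-vanish (suc k) second)) (count𝒫-vanish (suc k) end))
         (+-identityʳ² (∣𝒫∣ (2 + k))))
  where
  front : ∀ {x xs} → All (_< 3 + k) (x ∷ xs) → headIsMax (3 + k ∷ x ∷ xs) ≡ true
  front {x} {xs} <σ = all-<ᵇ (x ∷ xs) <σ
  second : ∀ {x xs} → All (_< 3 + k) (x ∷ xs) → headIsMax (x ∷ xs) ∧ headIsMax (x ∷ 3 + k ∷ xs) ≡ false
  second {x} {xs} (x<m ∷ _) rewrite headIsMax-insertSecond xs x<m = ∧-zeroʳ (headIsMax (x ∷ xs))
  end : ∀ {x xs} → All (_< 3 + k) (x ∷ xs) → headIsMax (x ∷ xs ++ [ 3 + k ]) ≡ false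
  end {x} {xs} (x<m ∷ _) = headIsMax-∷ʳmax xs x<m

a₁≡∣𝒫∣ : ∀ k → a 1 (3 + k) ≡ ∣𝒫∣ (2 + k)
a₁≡∣𝒫∣ k = trans (a-suc 0 k) (cong₂ (λ u v → u + v + ∣𝒫∣ (2 + k)) (a-zero (1 + k)) (aᵐ₁-vanish k))
  where
  aᵐ₁-vanish : ∀ k → aᵐ 1 (2 + k) ≡ 0
  aᵐ₁-vanish zero    = refl
  aᵐ₁-vanish (suc k) = trans (aᵐ-suc 0 k) (a-zero (suc k))

∣𝒫∣-pell : ∀ k → ∣𝒫∣ (2 + k) ≡ pell (2 + k)
∣𝒫∣-pell zero          = refl
∣𝒫∣-pell (suc zero)    = refl
∣𝒫∣-pell (suc (suc k)) = begin
  ∣𝒫∣ (4 + k)                                ≡⟨ ∣𝒫∣-suc (suc k) ⟩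
  ∣𝒫∣ (3 + k) + ∣𝒫ᵐ∣ (3 + k) + ∣𝒫∣ (3 + k)   ≡⟨ cong (λ n → ∣𝒫∣ (3 + k) + n + ∣𝒫∣ (3 + k)) (∣𝒫ᵐ∣-suc k) ⟩
  ∣𝒫∣ (3 + k) + ∣𝒫∣ (2 + k) + ∣𝒫∣ (3 + k)    ≡⟨ x+y+x≡2x+y (∣𝒫∣ (3 + k)) (∣𝒫∣ (2 + k)) ⟩
  2 * ∣𝒫∣ (3 + k) + ∣𝒫∣ (2 + k)              ≡⟨ cong₂ (λ u v → 2 * u + v) (∣𝒫∣-pell (suc k)) (∣𝒫∣-pell k) ⟩
  pell (4 + k)                               ∎
  where
  open ≡-Reasoning
  x+y+x≡2x+y : ∀ x y → x + y + x ≡ 2 * x + y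
  x+y+x≡2x+y = solve-∀

a₁-pell : ∀ n → a 1 (2 + n) ≡ pell (1 + n)
a₁-pell zero    = refl
a₁-pell (suc k) = trans (a₁≡∣𝒫∣ k) (∣𝒫∣-pell k)

a-rec : ∀ r n → a (2 + r) (2 + n) ≡ a (1 + r) (1 + n) + a (1 + r) n
a-rec zero          zero          = refl
a-rec (suc r)       zero          = refl
a-rec zero          (suc zero)    = refl
a-rec (suc zero)    (suc zero)    = refl
a-rec (suc (suc r)) (suc zero)    = refl
a-rec r             (suc (suc k)) = begin
  a (2 + r) (4 + k)
    ≡⟨ a-suc (suc r) (suc k) ⟩
  a (1 + r) (3 + k) + aᵐ (2 + r) (3 + k) + count𝒫 (λ _ → false) (3 + k)
    ≡⟨ cong₂ (λ u v → a (1 + r) (3 + k) + u + v) (aᵐ-suc (suc r) k) (count𝒫-vanish (2 + k) (λ _ → refl)) ⟩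
  a (1 + r) (3 + k) + a (1 + r) (2 + k) + 0
    ≡⟨ +-identityʳ _ ⟩
  a (1 + r) (3 + k) + a (1 + r) (2 + k) ∎
  where open ≡-Reasoning

a₂-pell : ∀ n → a 2 (4 + n) ≡ pell (2 + n) + pell (1 + n)
a₂-pell n = trans (a-rec 0 (2 + n)) (cong₂ _+_ (a₁-pell (1 + n)) (a₁-pell n))

a₃-pell : ∀ n → a 3 (6 + n) ≡ 2 * pell (3 + n)
a₃-pell n = trans (a-rec 1 (4 + n)) (trans (cong₂ _+_ (a₂-pell (1 + n)) (a₂-pell n)) (regroup (pell (2 + n)) (pell (1 + n))))
  where
  regroup : ∀ x y → (2 * x + y + x) + (x + y) ≡ 2 * (2 * x + y)
  regroup = solve-∀

shift : Series → Series
shift f zero    = 0ℤ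
shift f (suc n) = f n

_+ₛ_ : Series → Series → Series
(f +ₛ g) n = f n ℤ.+ g n

horner : List ℤ → Series → Series
horner []       h n = 0ℤ
horner (c ∷ cs) h n = c ℤ.* h n ℤ.+ shift (horner cs h) n

shift-cong : ∀ {f g} → f ≗ g → shift f ≗ shift g
shift-cong f≗g zero    = refl
shift-cong f≗g (suc n) = f≗g n

distribʳ-regroup : ∀ a b c x y → (a ℤ.+ b) ℤ.* c ℤ.+ (x ℤ.+ y) ≡ (a ℤ.* c ℤ.+ x) ℤ.+ (b ℤ.* c ℤ.+ y)
distribʳ-regroup = ℤ-solve

distribˡ-regroup : ∀ c a b x y → c ℤ.* (a ℤ.+ b) ℤ.+ (x ℤ.+ y) ≡ (c ℤ.* a ℤ.+ x) ℤ.+ (c ℤ.* b ℤ.+ y)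
distribˡ-regroup = ℤ-solve

⊛-suc : ∀ f g n → (f ⊛ g) (suc n) ≡ f 0 ℤ.* g (suc n) ℤ.+ ((f ∘ suc) ⊛ g) n
⊛-suc f g n = cong (λ l → f 0 ℤ.* g (suc n) ℤ.+ foldr ℤ._+_ 0ℤ l)
  (trans (map-applyUpTo suc (λ i → f i ℤ.* g (suc n ∸ i)) (suc n)) (sym (map-upTo (λ i → f (suc i) ℤ.* g (n ∸ i)) (suc n))))

⊛-congˡ : ∀ {f f′} g → f ≗ f′ → (f ⊛ g) ≗ (f′ ⊛ g)
⊛-congˡ g f≗f′ n = cong (foldr ℤ._+_ 0ℤ) (map-cong (λ i → cong (ℤ._* g (n ∸ i)) (f≗f′ i)) (upTo (suc n)))

⊛-congʳ : ∀ f {g g′} → g ≗ g′ → (f ⊛ g) ≗ (f ⊛ g′)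
⊛-congʳ f g≗g′ n = cong (foldr ℤ._+_ 0ℤ) (map-cong (λ i → cong (f i ℤ.*_) (g≗g′ (n ∸ i))) (upTo (suc n)))

⊛-distribʳ-+ : ∀ f f′ g → ((f +ₛ f′) ⊛ g) ≗ ((f ⊛ g) +ₛ (f′ ⊛ g))
⊛-distribʳ-+ f f′ g zero    = distribʳ-regroup (f 0) (f′ 0) (g 0) 0ℤ 0ℤ
⊛-distribʳ-+ f f′ g (suc n) = begin
  ((f +ₛ f′) ⊛ g) (suc n)
    ≡⟨ ⊛-suc (f +ₛ f′) g n ⟩
  (f 0 ℤ.+ f′ 0) ℤ.* g (suc n) ℤ.+ (((f ∘ suc) +ₛ (f′ ∘ suc)) ⊛ g) n
    ≡⟨ cong (ℤ._+_ ((f 0 ℤ.+ f′ 0) ℤ.* g (suc n))) (⊛-distribʳ-+ (f ∘ suc) (f′ ∘ suc) g n) ⟩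
  (f 0 ℤ.+ f′ 0) ℤ.* g (suc n) ℤ.+ (((f ∘ suc) ⊛ g) n ℤ.+ ((f′ ∘ suc) ⊛ g) n)
    ≡⟨ distribʳ-regroup (f 0) (f′ 0) (g (suc n)) _ _ ⟩
  (f 0 ℤ.* g (suc n) ℤ.+ ((f ∘ suc) ⊛ g) n) ℤ.+ (f′ 0 ℤ.* g (suc n) ℤ.+ ((f′ ∘ suc) ⊛ g) n)
    ≡⟨ sym (cong₂ ℤ._+_ (⊛-suc f g n) (⊛-suc f′ g n)) ⟩
  (f ⊛ g) (suc n) ℤ.+ (f′ ⊛ g) (suc n) ∎
  where open ≡-Reasoning

⊛-distribˡ-+ : ∀ f g g′ → (f ⊛ (g +ₛ g′)) ≗ ((f ⊛ g) +ₛ (f ⊛ g′))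
⊛-distribˡ-+ f g g′ zero    = distribˡ-regroup (f 0) (g 0) (g′ 0) 0ℤ 0ℤ
⊛-distribˡ-+ f g g′ (suc n) = begin
  (f ⊛ (g +ₛ g′)) (suc n)
    ≡⟨ ⊛-suc f (g +ₛ g′) n ⟩
  f 0 ℤ.* (g (suc n) ℤ.+ g′ (suc n)) ℤ.+ ((f ∘ suc) ⊛ (g +ₛ g′)) n
    ≡⟨ cong (ℤ._+_ (f 0 ℤ.* (g (suc n) ℤ.+ g′ (suc n)))) (⊛-distribˡ-+ (f ∘ suc) g g′ n) ⟩
  f 0 ℤ.* (g (suc n) ℤ.+ g′ (suc n)) ℤ.+ (((f ∘ suc) ⊛ g) n ℤ.+ ((f ∘ suc) ⊛ g′) n)
    ≡⟨ distribˡ-regroup (f 0) (g (suc n)) (g′ (suc n)) _ _ ⟩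
  (f 0 ℤ.* g (suc n) ℤ.+ ((f ∘ suc) ⊛ g) n) ℤ.+ (f 0 ℤ.* g′ (suc n) ℤ.+ ((f ∘ suc) ⊛ g′) n)
    ≡⟨ sym (cong₂ ℤ._+_ (⊛-suc f g n) (⊛-suc f g′ n)) ⟩
  (f ⊛ g) (suc n) ℤ.+ (f ⊛ g′) (suc n) ∎
  where open ≡-Reasoning

shift-⊛ : ∀ f g → (shift f ⊛ g) ≗ shift (f ⊛ g)
shift-⊛ f g zero    = refl
shift-⊛ f g (suc n) = trans (⊛-suc (shift f) g n) (ℤ.+-identityˡ ((f ⊛ g) n))

⊛-shift : ∀ f g → (f ⊛ shift g) ≗ shift (f ⊛ g)
⊛-shift f g zero          = cong (ℤ._+ 0ℤ) (ℤ.*-zeroʳ (f 0))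
⊛-shift f g (suc zero)    = trans (⊛-suc f (shift g) 0) (cong (ℤ._+_ (f 0 ℤ.* g 0)) (⊛-shift (f ∘ suc) g 0))
⊛-shift f g (suc (suc n)) =
  trans (⊛-suc f (shift g) (suc n))
        (trans (cong (ℤ._+_ (f 0 ℤ.* g (suc n))) (⊛-shift (f ∘ suc) g (suc n))) (sym (⊛-suc f g n)))

poly-⊛ : ∀ cs h → (poly cs ⊛ h) ≗ horner cs h
poly-⊛ []       h zero    = refl
poly-⊛ []       h (suc n) = trans (⊛-suc (poly []) h n) (trans (ℤ.+-identityˡ _) (poly-⊛ [] h n))
poly-⊛ (c ∷ cs) h zero    = refl
poly-⊛ (c ∷ cs) h (suc n) = trans (⊛-suc (poly (c ∷ cs)) h n) (cong (ℤ._+_ (c ℤ.* h (suc n))) (poly-⊛ cs h n))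

horner-1 : ∀ h → horner [ ℤ.1ℤ ] h ≗ h
horner-1 h zero    = trans (ℤ.+-identityʳ _) (ℤ.*-identityˡ (h 0))
horner-1 h (suc n) = trans (ℤ.+-identityʳ _) (ℤ.*-identityˡ (h (suc n)))

one-⊛ : ∀ h → (one ⊛ h) ≗ h
one-⊛ h n = trans (poly-⊛ [ ℤ.1ℤ ] h n) (horner-1 h n)

X-⊛ : ∀ h → (X ⊛ h) ≗ shift h
X-⊛ h n = trans (poly-⊛ (0ℤ ∷ ℤ.1ℤ ∷ []) h n) (trans (ℤ.+-identityˡ _) (shift-cong (horner-1 h) n))

onePlusX-⊛ : ∀ h → (onePlusX ⊛ h) ≗ (h +ₛ shift h)
onePlusX-⊛ h n = trans (poly-⊛ (ℤ.1ℤ ∷ ℤ.1ℤ ∷ []) h n) (cong₂ ℤ._+_ (ℤ.*-identityˡ (h n)) (shift-cong (horner-1 h) n))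

X^suc-⊛ : ∀ k h → ((X ^ₛ suc k) ⊛ h) ≗ shift ((X ^ₛ k) ⊛ h)
X^suc-⊛ k h n = trans (⊛-congˡ h (X-⊛ (X ^ₛ k)) n) (shift-⊛ (X ^ₛ k) h n)

numer-1 : numer 1 ≗ shift oneMinusXMinusX²
numer-1 n = trans (X^suc-⊛ 0 (one ⊛ oneMinusXMinusX²) n)
                  (shift-cong (λ m → trans (one-⊛ (one ⊛ oneMinusXMinusX²) m) (one-⊛ oneMinusXMinusX² m)) n)

numer-suc : ∀ r → numer (2 + r) ≗ (shift (numer (1 + r)) +ₛ shift (shift (numer (1 + r))))
numer-suc r n = begin
  ((X ^ₛ (2 + r)) ⊛ ((onePlusX ^ₛ suc r) ⊛ oneMinusXMinusX²)) n
    ≡⟨ ⊛-congʳ (X ^ₛ (2 + r)) R-suc n ⟩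
  ((X ^ₛ (2 + r)) ⊛ (R +ₛ shift R)) n
    ≡⟨ ⊛-distribˡ-+ (X ^ₛ (2 + r)) R (shift R) n ⟩
  ((X ^ₛ (2 + r)) ⊛ R) n ℤ.+ ((X ^ₛ (2 + r)) ⊛ shift R) n
    ≡⟨ cong₂ ℤ._+_ (X^suc-⊛ (1 + r) R n) (trans (⊛-shift (X ^ₛ (2 + r)) R n) (shift-cong (X^suc-⊛ (1 + r) R) n)) ⟩
  shift (numer (1 + r)) n ℤ.+ shift (shift (numer (1 + r))) n ∎
  where
  open ≡-Reasoning
  R : Series
  R = (onePlusX ^ₛ r) ⊛ oneMinusXMinusX²
  R-suc : ((onePlusX ^ₛ suc r) ⊛ oneMinusXMinusX²) ≗ (R +ₛ shift R)
  R-suc m = trans (⊛-congˡ oneMinusXMinusX² (onePlusX-⊛ (onePlusX ^ₛ r)) m)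
                  (trans (⊛-distribʳ-+ (onePlusX ^ₛ r) (shift (onePlusX ^ₛ r)) oneMinusXMinusX² m)
                         (cong (ℤ._+_ (R m)) (shift-⊛ (onePlusX ^ₛ r) oneMinusXMinusX² m)))

A-rec : ∀ r → A (2 + r) ≗ (shift (A (1 + r)) +ₛ shift (shift (A (1 + r))))
A-rec r zero          = refl
A-rec r (suc zero)    = refl
A-rec r (suc (suc n)) = trans (cong ℤ.+_ (a-rec r n)) (ℤ.pos-+ (a (1 + r) (1 + n)) (a (1 + r) n))

A₁-pell-rec : ∀ n → A 1 (5 + n) ≡ ℤ.+ 2 ℤ.* A 1 (4 + n) ℤ.+ A 1 (3 + n)
A₁-pell-rec n = begin
  ℤ.+ a 1 (5 + n)
    ≡⟨ cong ℤ.+_ (a₁-pell (3 + n)) ⟩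
  ℤ.+ (2 * pell (3 + n) + pell (2 + n))
    ≡⟨ trans (ℤ.pos-+ (2 * pell (3 + n)) (pell (2 + n))) (cong (ℤ._+ ℤ.+ pell (2 + n)) (ℤ.pos-* 2 (pell (3 + n)))) ⟩
  ℤ.+ 2 ℤ.* ℤ.+ pell (3 + n) ℤ.+ ℤ.+ pell (2 + n)
    ≡⟨ sym (cong₂ (λ u v → ℤ.+ 2 ℤ.* ℤ.+ u ℤ.+ ℤ.+ v) (a₁-pell (2 + n)) (a₁-pell (1 + n))) ⟩
  ℤ.+ 2 ℤ.* A 1 (4 + n) ℤ.+ A 1 (3 + n) ∎
  where open ≡-Reasoning

denom-A₁ : (denom ⊛ A 1) ≗ shift oneMinusXMinusX²
denom-A₁ 0 = refl
denom-A₁ 1 = refl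
denom-A₁ 2 = refl
denom-A₁ 3 = refl
denom-A₁ 4 = refl
denom-A₁ (suc (suc (suc (suc (suc n))))) =
  trans (poly-⊛ (ℤ.1ℤ ∷ ℤ.- ℤ.+ 2 ∷ ℤ.- ℤ.+ 1 ∷ []) (A 1) (5 + n)) (annihilated {A 1 (4 + n)} {A 1 (3 + n)} (A₁-pell-rec n))
  where
  annihilated : ∀ {u v w} → w ≡ ℤ.+ 2 ℤ.* u ℤ.+ v →
    ℤ.1ℤ ℤ.* w ℤ.+ ((ℤ.- ℤ.+ 2) ℤ.* u ℤ.+ ((ℤ.- ℤ.+ 1) ℤ.* v ℤ.+ 0ℤ)) ≡ 0ℤ
  annihilated {u} {v} refl = cancel u v
    where
    cancel : ∀ u v → ℤ.1ℤ ℤ.* (ℤ.+ 2 ℤ.* u ℤ.+ v) ℤ.+ ((ℤ.- ℤ.+ 2) ℤ.* u ℤ.+ ((ℤ.- ℤ.+ 1) ℤ.* v ℤ.+ 0ℤ)) ≡ 0ℤ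
    cancel = ℤ-solve

generatingFunction : ∀ r → (denom ⊛ A (suc r)) ≗ numer (suc r)
generatingFunction zero    n = trans (denom-A₁ n) (sym (numer-1 n))
generatingFunction (suc r) n = begin
  (denom ⊛ A (2 + r)) n
    ≡⟨ ⊛-congʳ denom (A-rec r) n ⟩
  (denom ⊛ (shift A′ +ₛ shift (shift A′))) n
    ≡⟨ ⊛-distribˡ-+ denom (shift A′) (shift (shift A′)) n ⟩
  (denom ⊛ shift A′) n ℤ.+ (denom ⊛ shift (shift A′)) n
    ≡⟨ cong₂ ℤ._+_ (⊛-shift denom A′ n) (trans (⊛-shift denom (shift A′) n) (shift-cong (⊛-shift denom A′) n)) ⟩
  shift (denom ⊛ A′) n ℤ.+ shift (shift (denom ⊛ A′)) n
    ≡⟨ cong₂ ℤ._+_ (shift-cong (generatingFunction r) n) (shift-cong (shift-cong (generatingFunction r)) n) ⟩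
  shift (numer (1 + r)) n ℤ.+ shift (shift (numer (1 + r))) n
    ≡⟨ sym (numer-suc r n) ⟩
  numer (2 + r) n ∎
  where
  open ≡-Reasoning
  A′ : Series
  A′ = A (1 + r)

mainTheorem15 :
    ((r : ℕ) → 1 ≤ r → (n : ℕ) → (denom ⊛ A r) n ≡ numer r n)
    × ((n : ℕ) → 2 ≤ n → a 1 n ≡ pell (n ∸ 1))
    × ((n : ℕ) → 4 ≤ n → a 2 n ≡ pell (n ∸ 2) + pell (n ∸ 3))
    × ((n : ℕ) → 6 ≤ n → a 3 n ≡ 2 * pell (n ∸ 3))
mainTheorem15 = series , first , second , third
  where
  series : (r : ℕ) → 1 ≤ r → (n : ℕ) → (denom ⊛ A r) n ≡ numer r n
  series r 1≤r with m≤n⇒∃[o]m+o≡n 1≤r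
  ... | k , refl = generatingFunction k

  first : (n : ℕ) → 2 ≤ n → a 1 n ≡ pell (n ∸ 1)
  first n 2≤n with m≤n⇒∃[o]m+o≡n 2≤n
  ... | k , refl = a₁-pell k

  second : (n : ℕ) → 4 ≤ n → a 2 n ≡ pell (n ∸ 2) + pell (n ∸ 3)
  second n 4≤n with m≤n⇒∃[o]m+o≡n 4≤n
  ... | k , refl = a₂-pell k

  third : (n : ℕ) → 6 ≤ n → a 3 n ≡ 2 * pell (n ∸ 3)
  third n 6≤n with m≤n⇒∃[o]m+o≡n 6≤n
  ... | k , refl = a₃-pell k
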